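{- Let $n$ and $C$ be positive integers and let $S$ be a set of queens placed on distinct squares of an $n\times n$ chessboard. Suppose there is no collection of $C-1$ diagonals such that every queen of $S$ lies on one of these diagonals. Then there exists a set of $2C$ diagonals, each passing through at least one queen of $S$, the sum of whose lengths is at least $nC$.
   Context: A diagonal of the $n\times n$ board is a maximal set of squares lying on a line of slope $+1$ (positive diagonal) or $-1$ (negative diagonal); its length is its number of squares. -}

module Defs where

open import Data.Nat using (ℕ; _+_; _*_; _∸_; _≟_)
open import Data.Fin using (Fin; toℕ)
open import Data.Product using (_×_; _,_)
open import Data.List using (List; filter; allFin; cartesianProduct; length)
open import Relation.Binary.PropositionalEquality using (_≡_)
open import Relation.Nullary using (Dec)

-- A square of the n×n board: (row , column), both in {0,…,n-1}.
Square : ℕ → Set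
Square n = Fin n × Fin n

-- There are 2n-1 diagonals of each slope,
-- indexed by k ∈ {0,…,2n-2}.
--   pos k : squares (i , j) with  i - j + (n-1) = k   (slope +1)
--   neg k : squares (i , j) with  i + j = k           (slope -1)
data Diagonal (n : ℕ) : Set where
  pos : Fin (2 * n ∸ 1) → Diagonal n
  neg : Fin (2 * n ∸ 1) → Diagonal n

_onDiag_ : {n : ℕ} → Square n → Diagonal n → Set
_onDiag_ {n} (i , j) (pos k) = toℕ i + (n ∸ 1) ≡ toℕ k + toℕ j
_onDiag_ {n} (i , j) (neg k) = toℕ i + toℕ j ≡ toℕ k

onDiag? : {n : ℕ} (d : Diagonal n) (s : Square n) → Dec (s onDiag d)
onDiag? {n} (pos k) (i , j) = (toℕ i + (n ∸ 1)) ≟ (toℕ k + toℕ j)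
onDiag? {n} (neg k) (i , j) = (toℕ i + toℕ j) ≟ toℕ k

allSquares : (n : ℕ) → List (Square n)
allSquares n = cartesianProduct (allFin n) (allFin n)

diagLength : {n : ℕ} → Diagonal n → ℕ
diagLength {n} d = length (filter (onDiag? d) (allSquares n))

module Submission where

-- List the distinct positive diagonals through queens by decreasing length, and likewise the
-- negative ones.  For a + b = C - 1 the a longest positive and the b longest negative diagonals
-- do not cover S, so some queen q lies on none of them; hence the next positive diagonal in the
-- list is at least as long as the positive diagonal through q, and the next negative one at least
-- as long as the negative diagonal through q.  The two diagonals through any square have total
-- length at least n, because every row or every column of the board meets one of them.  Pairing
-- the a-th positive with the (C - 1 - a)-th negative diagonal for a < C, the C longest diagonals
-- of each kind have total length at least nC.

open import Defs
open import Data.Bool using (true; false)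
open import Data.Empty using (⊥-elim)
open import Data.Fin using (Fin; toℕ; fromℕ<) renaming (zero to fzero)
open import Data.Fin.Properties using (toℕ<n; toℕ-fromℕ<) renaming (_≟_ to _≟ᶠ_)
open import Data.List
  using (List; []; _∷_; _++_; _∷ʳ_; length; map; filter; take; drop; replicate; deduplicate; cartesianProduct; allFin)
open import Data.List.Properties
  using (length-++; length-take; length-replicate; length-tabulate; map-++; filter-++; filter-some; cartesianProductWith-zeroʳ)
open import Data.List.Membership.Propositional using (_∈_; _∉_; find; lose)
open import Data.List.Membership.Propositional.Properties
  using (∈-allFin; ∈-map⁺; ∈-map⁻; ∈-deduplicate⁺; ∈-deduplicate⁻; ∈-++⁺ˡ; ∈-++⁺ʳ)
open import Data.List.Relation.Binary.Disjoint.Propositional using (Disjoint)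
open import Data.List.Relation.Binary.Permutation.Propositional using (↭-sym; ↭⇒↭ₛ)
open import Data.List.Relation.Binary.Permutation.Propositional.Properties using (∈-resp-↭)
import Data.List.Relation.Binary.Permutation.Setoid.Properties as Permutationₛ
open import Data.List.Relation.Unary.All as All using (All)
import Data.List.Relation.Unary.All.Properties as Allₚ
open import Data.List.Relation.Unary.AllPairs using (AllPairs; _∷_)
open import Data.List.Relation.Unary.Any using (Any; here; there; any?)
import Data.List.Relation.Unary.Any.Properties as Anyₚ
open import Data.List.Relation.Unary.Sorted.TotalOrder.Properties using (Sorted⇒AllPairs)
open import Data.List.Relation.Unary.Unique.DecPropositional.Properties using (deduplicate-!)
open import Data.List.Relation.Unary.Unique.Propositional using (Unique)
import Data.List.Relation.Unary.Unique.Propositional.Properties as Uniqueₚ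
open import Data.Nat using (ℕ; zero; suc; _+_; _*_; _∸_; _≤_; _<_; _≥_; z≤n; s≤s; s≤s⁻¹; NonZero)
open import Data.Nat.ListAction using (sum)
open import Data.Nat.ListAction.Properties using (sum-++)
open import Data.Nat.Properties
open import Algebra.Properties.CommutativeSemigroup +-commutativeSemigroup using (xy∙z≈xz∙y; interchange)
open import Data.Nat.Tactic.RingSolver using (solve)
open import Data.Product using (proj₁; proj₂; Σ; Σ-syntax; ∃; ∃₂; ∃-syntax; _×_; _,_; swap)
open import Data.Sum as Sum using (_⊎_; inj₁; inj₂)
open import Function using (_∘_; id)
open import Level using (Level)
open import Relation.Binary.Bundles using (DecTotalOrder)
import Relation.Binary.Construct.Flip.Ord as Flip
import Relation.Binary.Construct.On as On
open import Relation.Binary.Definitions using (DecidableEquality)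
open import Relation.Binary.PropositionalEquality
open import Relation.Nullary using (¬_; does; no)
open import Relation.Nullary.Decidable using (map′)
open import Relation.Unary using (Pred; Decidable)

private
  variable
    a b p q : Level
    A : Set a
    B : Set b

count : {P : Pred A p} → Decidable P → List A → ℕ
count P? xs = length (filter P? xs)

count-++ : {P : Pred A p} (P? : Decidable P) → ∀ xs ys → count P? (xs ++ ys) ≡ count P? xs + count P? ys
count-++ P? xs ys = trans (cong length (filter-++ P? xs ys)) (length-++ (filter P? xs))

count-map : {P : Pred A p} (P? : Decidable P) (f : B → A) → ∀ xs → count P? (map f xs) ≡ count (P? ∘ f) xs
count-map P? f [] = refl
count-map P? f (x ∷ xs) with does (P? (f x))
... | true  = cong suc (count-map P? f xs)
... | false = count-map P? f xs

count-cartesianProduct-∷ˡ : {P : Pred (A × B) p} (P? : Decidable P) → ∀ x xs ys →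
  count P? (cartesianProduct (x ∷ xs) ys) ≡ count (λ y → P? (x , y)) ys + count P? (cartesianProduct xs ys)
count-cartesianProduct-∷ˡ P? x xs ys =
  trans (count-++ P? (map (x ,_) ys) _) (cong (_+ _) (count-map P? (x ,_) ys))

count-cartesianProduct-∷ʳ : {P : Pred (A × B) p} (P? : Decidable P) → ∀ xs y ys →
  count P? (cartesianProduct xs (y ∷ ys)) ≡ count (λ x → P? (x , y)) xs + count P? (cartesianProduct xs ys)
count-cartesianProduct-∷ʳ P? [] y ys = refl
count-cartesianProduct-∷ʳ P? (x ∷ xs) y ys = begin
  count P? ((x , y) ∷ row ++ rest (y ∷ ys))
    ≡⟨ count-++ P? ((x , y) ∷ row) _ ⟩
  count P? ((x , y) ∷ row) + count P? (rest (y ∷ ys))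
    ≡⟨ cong₂ _+_ (count-++ P? ((x , y) ∷ []) row) (count-cartesianProduct-∷ʳ P? xs y ys) ⟩
  (corner + count P? row) + (count Py xs + count P? (rest ys))
    ≡⟨ interchange corner (count P? row) (count Py xs) (count P? (rest ys)) ⟩
  (corner + count Py xs) + (count P? row + count P? (rest ys))
    ≡⟨ cong₂ _+_ (trans (cong (_+ count Py xs) (count-map P? (_, y) (x ∷ []))) (sym (count-++ Py (x ∷ []) xs)))
                 (sym (count-++ P? row (rest ys))) ⟩
  count Py (x ∷ xs) + count P? (cartesianProduct (x ∷ xs) ys) ∎
  where
  open ≡-Reasoning
  Py = λ x → P? (x , y)
  row = map (x ,_) ys
  rest = cartesianProduct xs
  corner = count P? ((x , y) ∷ [])

count-cartesianProduct-swap : {P : Pred (A × B) p} (P? : Decidable P) → ∀ xs ys →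
  count P? (cartesianProduct xs ys) ≡ count (P? ∘ swap) (cartesianProduct ys xs)
count-cartesianProduct-swap P? [] ys = sym (cong (count (P? ∘ swap)) (cartesianProductWith-zeroʳ _,_ ys))
count-cartesianProduct-swap P? (x ∷ xs) ys = begin
  count P? (cartesianProduct (x ∷ xs) ys)
    ≡⟨ count-cartesianProduct-∷ˡ P? x xs ys ⟩
  count (λ y → P? (x , y)) ys + count P? (cartesianProduct xs ys)
    ≡⟨ cong (_ +_) (count-cartesianProduct-swap P? xs ys) ⟩
  count (λ y → P? (x , y)) ys + count (P? ∘ swap) (cartesianProduct ys xs)
    ≡⟨ count-cartesianProduct-∷ʳ (P? ∘ swap) ys x xs ⟨
  count (P? ∘ swap) (cartesianProduct ys (x ∷ xs)) ∎
  where open ≡-Reasoning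

length≤count-cartesianProduct-byRows : {P : Pred (A × B) p} {Q : Pred (A × B) q}
  (P? : Decidable P) (Q? : Decidable Q) → ∀ xs ys →
  (∀ {x} → x ∈ xs → ∃[ y ] y ∈ ys × (P (x , y) ⊎ Q (x , y))) →
  length xs ≤ count P? (cartesianProduct xs ys) + count Q? (cartesianProduct xs ys)
length≤count-cartesianProduct-byRows P? Q? [] ys _ = z≤n
length≤count-cartesianProduct-byRows {P = P} {Q} P? Q? (x ∷ xs) ys meets = begin
  1 + length xs
    ≤⟨ +-mono-≤ (rowHit (meets (here refl))) (length≤count-cartesianProduct-byRows P? Q? xs ys (meets ∘ there)) ⟩
  (count Px ys + count Qx ys) + (count P? rest + count Q? rest)
    ≡⟨ interchange (count Px ys) (count Qx ys) (count P? rest) (count Q? rest) ⟩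
  (count Px ys + count P? rest) + (count Qx ys + count Q? rest)
    ≡⟨ cong₂ _+_ (count-cartesianProduct-∷ˡ P? x xs ys) (count-cartesianProduct-∷ˡ Q? x xs ys) ⟨
  count P? (cartesianProduct (x ∷ xs) ys) + count Q? (cartesianProduct (x ∷ xs) ys) ∎
  where
  open ≤-Reasoning
  Px = λ y → P? (x , y)
  Qx = λ y → Q? (x , y)
  rest = cartesianProduct xs ys
  rowHit : ∃[ y ] y ∈ ys × (P (x , y) ⊎ Q (x , y)) → 1 ≤ count Px ys + count Qx ys
  rowHit (y , y∈ys , inj₁ p) = ≤-trans (filter-some Px (lose y∈ys p)) (m≤m+n _ _)
  rowHit (y , y∈ys , inj₂ q) = ≤-trans (filter-some Qx (lose y∈ys q)) (m≤n+m _ _)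

length≤count-cartesianProduct-byColumns : {P : Pred (A × B) p} {Q : Pred (A × B) q}
  (P? : Decidable P) (Q? : Decidable Q) → ∀ xs ys →
  (∀ {y} → y ∈ ys → ∃[ x ] x ∈ xs × (P (x , y) ⊎ Q (x , y))) →
  length ys ≤ count P? (cartesianProduct xs ys) + count Q? (cartesianProduct xs ys)
length≤count-cartesianProduct-byColumns P? Q? xs ys meets =
  subst₂ (λ s t → length ys ≤ s + t)
    (sym (count-cartesianProduct-swap P? xs ys)) (sym (count-cartesianProduct-swap Q? xs ys))
    (length≤count-cartesianProduct-byRows (P? ∘ swap) (Q? ∘ swap) ys xs meets)

-- (x , y) lies on the positive diagonal through (i , j) iff x + j ≡ i + y,
-- and on the negative one iff x + y ≡ i + j.
RowMeetsDiagonalsThrough : ℕ → ℕ → ℕ → ℕ → Set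
RowMeetsDiagonalsThrough m i j x = ∃[ y ] y ≤ m × (x + j ≡ i + y ⊎ x + y ≡ i + j)

rowMeetsDiagonalsThrough-left : ∀ {m i j x} → j ≤ i → i + j ≤ m → x ≤ m →
                                RowMeetsDiagonalsThrough m i j x
rowMeetsDiagonalsThrough-left {m} {i} {j} {x} j≤i i+j≤m x≤m with ≤-total x (i + j)
... | inj₁ x≤i+j with m≤n⇒∃[o]m+o≡n x≤i+j
...   | t , x+t≡i+j = t , ≤-trans (m≤n+m t x) (subst (_≤ m) (sym x+t≡i+j) i+j≤m) , inj₂ x+t≡i+j
rowMeetsDiagonalsThrough-left {m} {i} {j} {x} j≤i i+j≤m x≤m | inj₂ i+j≤x
  with m≤n⇒∃[o]m+o≡n j≤i | m≤n⇒∃[o]m+o≡n i+j≤x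
... | a , refl | t , refl = j + t + j , y≤m , inj₁ (solve (j ∷ a ∷ t ∷ []))
  where
  x≡y+a : j + a + j + t ≡ j + t + j + a
  x≡y+a = solve (j ∷ a ∷ t ∷ [])
  y≤m : j + t + j ≤ m
  y≤m = ≤-trans (m≤m+n _ a) (subst (_≤ m) x≡y+a x≤m)

rowMeetsDiagonalsThrough-right : ∀ {m i j x} → i ≤ j → m ≤ i + j → j ≤ m → x ≤ m →
                                 RowMeetsDiagonalsThrough m i j x
rowMeetsDiagonalsThrough-right {m} {i} {j} {x} i≤j m≤i+j j≤m x≤m with m≤n⇒∃[o]m+o≡n i≤j
... | a , refl with ≤-total (x + a) m
...   | inj₁ x+a≤m = x + a , x+a≤m , inj₁ (solve (x ∷ i ∷ a ∷ []))
...   | inj₂ m≤x+a with m≤n⇒∃[o]m+o≡n (≤-trans x≤m m≤i+j)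
...     | t , x+t≡i+j = t , t≤m , inj₂ x+t≡i+j
  where
  i≤x : i ≤ x
  i≤x = +-cancelʳ-≤ a i x (≤-trans j≤m m≤x+a)
  t≤m : t ≤ m
  t≤m = +-cancelˡ-≤ x t m (≤-trans (≤-reflexive x+t≡i+j) (+-mono-≤ i≤x j≤m))

-- The second alternative says that every column meets a diagonal through (i , j):
-- transposing the board swaps rows with columns and i with j.
everyRowOrEveryColumnMeetsDiagonalsThrough : ∀ {m i j} → i ≤ m → j ≤ m →
  (∀ {x} → x ≤ m → RowMeetsDiagonalsThrough m i j x) ⊎
  (∀ {y} → y ≤ m → RowMeetsDiagonalsThrough m j i y)
everyRowOrEveryColumnMeetsDiagonalsThrough {m} {i} {j} i≤m j≤m with ≤-total j i | ≤-total (i + j) m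
... | inj₁ j≤i | inj₁ i+j≤m = inj₁ (rowMeetsDiagonalsThrough-left j≤i i+j≤m)
... | inj₂ i≤j | inj₂ m≤i+j = inj₁ (rowMeetsDiagonalsThrough-right i≤j m≤i+j j≤m)
... | inj₁ j≤i | inj₂ m≤i+j =
  inj₂ (rowMeetsDiagonalsThrough-right j≤i (subst (m ≤_) (+-comm i j) m≤i+j) i≤m)
... | inj₂ i≤j | inj₁ i+j≤m =
  inj₂ (rowMeetsDiagonalsThrough-left i≤j (subst (_≤ m) (+-comm i j) i+j≤m))

posIndex-correct : ∀ {m i j x y} → j ≤ i + m → x + j ≡ i + y → x + m ≡ (i + m ∸ j) + y
posIndex-correct {m} {i} {j} {x} {y} j≤i+m x+j≡i+y = +-cancelʳ-≡ j _ _ (begin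
  x + m + j          ≡⟨ xy∙z≈xz∙y x m j ⟩
  x + j + m          ≡⟨ cong (_+ m) x+j≡i+y ⟩
  i + y + m          ≡⟨ xy∙z≈xz∙y i y m ⟩
  i + m + y          ≡⟨ cong (_+ y) (m∸n+n≡m j≤i+m) ⟨
  i + m ∸ j + j + y  ≡⟨ xy∙z≈xz∙y (i + m ∸ j) j y ⟩
  i + m ∸ j + y + j  ∎)
  where open ≡-Reasoning

module _ {m : ℕ} where

  toℕ≤m : (i : Fin (suc m)) → toℕ i ≤ m
  toℕ≤m i = s≤s⁻¹ (toℕ<n i)

  diagonalIndex< : ∀ {k} → k ≤ m + m → k < 2 * suc m ∸ 1
  diagonalIndex< k≤m+m = ≤-<-trans k≤m+m (+-monoʳ-< m (s≤s (≤-reflexive (sym (+-identityʳ m)))))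

  posIndex< : (i j : Fin (suc m)) → toℕ i + m ∸ toℕ j < 2 * suc m ∸ 1
  posIndex< i j = diagonalIndex< (≤-trans (m∸n≤m (toℕ i + m) (toℕ j)) (+-monoˡ-≤ m (toℕ≤m i)))

  negIndex< : (i j : Fin (suc m)) → toℕ i + toℕ j < 2 * suc m ∸ 1
  negIndex< i j = diagonalIndex< (+-mono-≤ (toℕ≤m i) (toℕ≤m j))

  posThrough negThrough : Square (suc m) → Diagonal (suc m)
  posThrough (i , j) = pos (fromℕ< (posIndex< i j))
  negThrough (i , j) = neg (fromℕ< (negIndex< i j))

  onPosThrough : ∀ {i j x y : Fin (suc m)} → toℕ x + toℕ j ≡ toℕ i + toℕ y → (x , y) onDiag posThrough (i , j)
  onPosThrough {i} {j} e rewrite toℕ-fromℕ< (posIndex< i j) =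
    posIndex-correct (≤-trans (toℕ≤m j) (m≤n+m m (toℕ i))) e

  onNegThrough : ∀ {i j x y : Fin (suc m)} → toℕ x + toℕ y ≡ toℕ i + toℕ j → (x , y) onDiag negThrough (i , j)
  onNegThrough {i} {j} e rewrite toℕ-fromℕ< (negIndex< i j) = e

  onPosThrough-self : (q : Square (suc m)) → q onDiag posThrough q
  onPosThrough-self (i , j) = onPosThrough {i} {j} refl

  onNegThrough-self : (q : Square (suc m)) → q onDiag negThrough q
  onNegThrough-self (i , j) = onNegThrough {i} {j} {i} {j} refl

  OnDiagonalsThrough : Square (suc m) → Square (suc m) → Set
  OnDiagonalsThrough q s = s onDiag posThrough q ⊎ s onDiag negThrough q

  rowMeets⇒square : ∀ {i j x} → RowMeetsDiagonalsThrough m (toℕ i) (toℕ j) (toℕ x) →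
                    ∃[ y ] y ∈ allFin (suc m) × OnDiagonalsThrough (i , j) (x , y)
  rowMeets⇒square {i} {j} {x} (y , y≤m , meets) with fromℕ< (s≤s y≤m) | toℕ-fromℕ< (s≤s y≤m)
  ... | y′ | refl = y′ , ∈-allFin y′ , Sum.map (onPosThrough {i} {j} {x}) (onNegThrough {i} {j} {x} {y′}) meets

  columnMeets⇒square : ∀ {i j y} → RowMeetsDiagonalsThrough m (toℕ j) (toℕ i) (toℕ y) →
                       ∃[ x ] x ∈ allFin (suc m) × OnDiagonalsThrough (i , j) (x , y)
  columnMeets⇒square {i} {j} {y} (x , x≤m , meets) with fromℕ< (s≤s x≤m) | toℕ-fromℕ< (s≤s x≤m)
  ... | x′ | refl = x′ , ∈-allFin x′ , Sum.map onPos onNeg meets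
    where
    onPos : toℕ y + toℕ i ≡ toℕ j + toℕ x′ → (x′ , y) onDiag posThrough (i , j)
    onPos e = onPosThrough {i} {j} {x′} {y} (trans (+-comm (toℕ x′) (toℕ j)) (trans (sym e) (+-comm (toℕ y) (toℕ i))))
    onNeg : toℕ y + toℕ x′ ≡ toℕ j + toℕ i → (x′ , y) onDiag negThrough (i , j)
    onNeg e = onNegThrough {i} {j} {x′} {y} (trans (+-comm (toℕ x′) (toℕ y)) (trans e (+-comm (toℕ j) (toℕ i))))

  length-posThrough+negThrough : (q : Square (suc m)) →
                                 suc m ≤ diagLength (posThrough q) + diagLength (negThrough q)
  length-posThrough+negThrough q@(i , j)
    with everyRowOrEveryColumnMeetsDiagonalsThrough (toℕ≤m i) (toℕ≤m j)
  ... | inj₁ rows = ≤-trans (≤-reflexive (sym (length-tabulate id)))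
        (length≤count-cartesianProduct-byRows (onDiag? (posThrough q)) (onDiag? (negThrough q))
          (allFin _) (allFin _) (λ {x} _ → rowMeets⇒square (rows (toℕ≤m x))))
  ... | inj₂ columns = ≤-trans (≤-reflexive (sym (length-tabulate id)))
        (length≤count-cartesianProduct-byColumns (onDiag? (posThrough q)) (onDiag? (negThrough q))
          (allFin _) (allFin _) (λ {y} _ → columnMeets⇒square (columns (toℕ≤m y))))

_[_]=_ : List A → ℕ → A → Set _
xs [ i ]= d = ∃ λ r → drop i xs ≡ d ∷ r

take-suc-[]= : {xs : List A} {d : A} → ∀ i → xs [ i ]= d → take (suc i) xs ≡ take i xs ∷ʳ d
take-suc-[]= {xs = d ∷ r} zero (r , refl) = refl
take-suc-[]= {xs = x ∷ xs} (suc i) xs[i]=d = cong (x ∷_) (take-suc-[]= i xs[i]=d)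

length-take≤ : ∀ n (xs : List A) → length (take n xs) ≤ n
length-take≤ n xs = ≤-trans (≤-reflexive (length-take n xs)) (m⊓n≤m n (length xs))

sum-map-∷ʳ : (f : A → ℕ) → ∀ xs x → sum (map f (xs ∷ʳ x)) ≡ sum (map f xs) + f x
sum-map-∷ʳ f xs x = begin
  sum (map f (xs ∷ʳ x))         ≡⟨ cong sum (map-++ f xs (x ∷ [])) ⟩
  sum (map f xs ++ f x ∷ [])    ≡⟨ sum-++ (map f xs) (f x ∷ []) ⟩
  sum (map f xs) + (f x + 0)    ≡⟨ cong (sum (map f xs) +_) (+-identityʳ (f x)) ⟩
  sum (map f xs) + f x          ∎
  where open ≡-Reasoning

module _ {D : Set} (L : D → ℕ) where

  Descending : List D → Set
  Descending = AllPairs (λ d e → L e ≤ L d)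

  descending-∉-take : ∀ {z} a xs → Descending xs → z ∈ xs → z ∉ take a xs →
                      ∃ λ d → xs [ a ]= d × L z ≤ L d
  descending-∉-take zero    (d ∷ r) _           (here refl)  _  = d , (r , refl) , ≤-refl
  descending-∉-take zero    (d ∷ r) (d≥r ∷ _)   (there z∈r)  _  = d , (r , refl) , All.lookup d≥r z∈r
  descending-∉-take (suc a) (x ∷ xs) _          (here refl)  z∉ = ⊥-elim (z∉ (here refl))
  descending-∉-take (suc a) (x ∷ xs) (_ ∷ desc) (there z∈xs) z∉ =
    descending-∉-take a xs desc z∈xs (z∉ ∘ there)

  HeavyPairs : ℕ → ℕ → List D → List D → Set
  HeavyPairs N C xs ys = ∀ a b → suc (a + b) ≡ C → ∃₂ λ d e → xs [ a ]= d × ys [ b ]= e × N ≤ L d + L e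

  take-heavyPairs : ∀ {N} C xs ys → HeavyPairs N C xs ys →
    length (take C xs) ≡ C × length (take C ys) ≡ C ×
    N * C ≤ sum (map L (take C xs)) + sum (map L (take C ys))
  take-heavyPairs {N} zero xs ys _ = refl , refl , ≤-reflexive (*-zeroʳ N)
  take-heavyPairs {N} (suc C) xs ys heavy with heavy 0 C refl
  ... | d , e , (r , refl) , ys[C]=e , N≤d+e
    with take-heavyPairs C r ys (λ a b eq → heavy (suc a) b (cong suc eq))
  ... | length-r , length-ys , bound = cong suc length-r , length-ys′ , bound′
    where
    length-ys′ : length (take (suc C) ys) ≡ suc C
    length-ys′ = begin
      length (take (suc C) ys)        ≡⟨ cong length (take-suc-[]= C ys[C]=e) ⟩
      length (take C ys ∷ʳ e)         ≡⟨ length-++ (take C ys) ⟩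
      length (take C ys) + 1          ≡⟨ cong (_+ 1) length-ys ⟩
      C + 1                           ≡⟨ +-comm C 1 ⟩
      suc C                           ∎
      where open ≡-Reasoning
    Sr = sum (map L (take C r))
    Sys = sum (map L (take C ys))
    bound′ : N * suc C ≤ sum (map L (take (suc C) (d ∷ r))) + sum (map L (take (suc C) ys))
    bound′ = begin
      N * suc C                 ≡⟨ *-suc N C ⟩
      N + N * C                 ≤⟨ +-mono-≤ N≤d+e bound ⟩
      (L d + L e) + (Sr + Sys)  ≡⟨ interchange (L d) (L e) Sr Sys ⟩
      (L d + Sr) + (L e + Sys)  ≡⟨ cong ((L d + Sr) +_) (+-comm (L e) Sys) ⟩
      (L d + Sr) + (Sys + L e)  ≡⟨ cong ((L d + Sr) +_) (sum-map-∷ʳ L (take C ys) e) ⟨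
      (L d + Sr) + sum (map L (take C ys ∷ʳ e))
        ≡⟨ cong (λ t → (L d + Sr) + sum (map L t)) (take-suc-[]= C ys[C]=e) ⟨
      sum (map L (take (suc C) (d ∷ r))) + sum (map L (take (suc C) ys)) ∎
      where open ≤-Reasoning

module SortedImage {Q D : Set} (_≟_ : DecidableEquality D) (L : D → ℕ) (f : Q → D) where

  private
    byDecreasingL : DecTotalOrder _ _ _
    byDecreasingL = On.decTotalOrder (Flip.decTotalOrder ≤-decTotalOrder) L

  open import Data.List.Sort byDecreasingL using (sort; sort-↭; sort-↗)

  sortedImage : List Q → List D
  sortedImage S = sort (deduplicate _≟_ (map f S))

  sortedImage-unique : ∀ S → Unique (sortedImage S)
  sortedImage-unique S =
    Permutationₛ.Unique-resp-↭ (setoid D) (↭⇒↭ₛ (↭-sym (sort-↭ _))) (deduplicate-! _≟_ (map f S))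

  take-sortedImage⁻ : ∀ C S → All (λ d → ∃ λ q → q ∈ S × d ≡ f q) (take C (sortedImage S))
  take-sortedImage⁻ C S = Allₚ.take⁺ C (All.tabulate λ d∈ →
    ∈-map⁻ f (∈-deduplicate⁻ _≟_ (map f S) (∈-resp-↭ (sort-↭ _) d∈)))

  sortedImage-∉-take : ∀ {S q} a → q ∈ S → f q ∉ take a (sortedImage S) →
                       ∃ λ d → sortedImage S [ a ]= d × L (f q) ≤ L d
  sortedImage-∉-take a q∈S = descending-∉-take L a _
    (Sorted⇒AllPairs (DecTotalOrder.totalOrder byDecreasingL) (sort-↗ _))
    (∈-resp-↭ (↭-sym (sort-↭ _)) (∈-deduplicate⁺ _≟_ (∈-map⁺ f q∈S)))

_≟ᵈ_ : ∀ {n} → DecidableEquality (Diagonal n)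
pos k ≟ᵈ pos l = map′ (cong pos) (λ { refl → refl }) (k ≟ᶠ l)
neg k ≟ᵈ neg l = map′ (cong neg) (λ { refl → refl }) (k ≟ᶠ l)
pos k ≟ᵈ neg l = no λ ()
neg k ≟ᵈ pos l = no λ ()

Covers : ∀ {n} → List (Diagonal n) → List (Square n) → Set
Covers D S = All (λ q → Any (q onDiag_) D) S

padCover : ∀ {n k} {D : List (Diagonal n)} {S} → Diagonal n → length D ≤ k → Covers D S →
           Σ[ D′ ∈ List (Diagonal n) ] length D′ ≡ k × Covers D′ S
padCover {k = k} {D} d₀ D≤k covers =
  D ++ replicate (k ∸ length D) d₀ ,
  trans (length-++ D) (trans (cong (length D +_) (length-replicate (k ∸ length D))) (m+[n∸m]≡n D≤k)) ,
  All.map Anyₚ.++⁺ˡ covers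

uncoveredQueen : ∀ {n} D (S : List (Square n)) → ¬ Covers D S → ∃ λ q → q ∈ S × ¬ Any (q onDiag_) D
uncoveredQueen D S ¬covers = find (Allₚ.¬All⇒Any¬ (λ q → any? (λ d → onDiag? d q) D) S ¬covers)

module _ {m : ℕ} where

  module Pos = SortedImage _≟ᵈ_ diagLength (posThrough {m})
  module Neg = SortedImage _≟ᵈ_ diagLength (negThrough {m})

  topDiagonals : ℕ → ℕ → List (Square (suc m)) → List (Diagonal (suc m))
  topDiagonals a b S = take a (Pos.sortedImage S) ++ take b (Neg.sortedImage S)

  length-topDiagonals : ∀ {C} a b S → suc (a + b) ≡ C → length (topDiagonals a b S) ≤ C ∸ 1
  length-topDiagonals {C} a b S 1+a+b≡C = begin
    length (take a (Pos.sortedImage S) ++ take b (Neg.sortedImage S))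
      ≡⟨ length-++ (take a (Pos.sortedImage S)) ⟩
    length (take a (Pos.sortedImage S)) + length (take b (Neg.sortedImage S))
      ≤⟨ +-mono-≤ (length-take≤ a _) (length-take≤ b _) ⟩
    a + b
      ≡⟨ cong (_∸ 1) 1+a+b≡C ⟩
    C ∸ 1 ∎
    where open ≤-Reasoning

  uncoverable⇒heavyPairs : ∀ C S →
    ¬ (Σ[ D ∈ List (Diagonal (suc m)) ] length D ≡ C ∸ 1 × Covers D S) →
    HeavyPairs diagLength (suc m) C (Pos.sortedImage S) (Neg.sortedImage S)
  uncoverable⇒heavyPairs C S uncoverable a b 1+a+b≡C
    with q , q∈S , q-uncovered ← uncoveredQueen (topDiagonals a b S) S
           (uncoverable ∘ padCover (posThrough (fzero , fzero)) (length-topDiagonals a b S 1+a+b≡C))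
    with d , P[a]=d , pos≤d ← Pos.sortedImage-∉-take a q∈S
           (λ t → q-uncovered (lose (∈-++⁺ˡ t) (onPosThrough-self q)))
    with e , N[b]=e , neg≤e ← Neg.sortedImage-∉-take b q∈S
           (λ t → q-uncovered (lose (∈-++⁺ʳ (take a (Pos.sortedImage S)) t) (onNegThrough-self q)))
    = d , e , P[a]=d , N[b]=e , ≤-trans (length-posThrough+negThrough q) (+-mono-≤ pos≤d neg≤e)

  take-sortedImages-disjoint : ∀ C S → Disjoint (take C (Pos.sortedImage S)) (take C (Neg.sortedImage S))
  take-sortedImages-disjoint C S (d∈P , d∈N)
    with All.lookup (Pos.take-sortedImage⁻ C S) d∈P | All.lookup (Neg.take-sortedImage⁻ C S) d∈N
  ... | _ , _ , refl | _ , _ , ()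

lemma2 : (n C : ℕ) → .{{NonZero n}} → .{{NonZero C}} →
    (S : List (Square n)) → Unique S →
    ¬ (Σ (List (Diagonal n)) (λ D → (length D ≡ C ∸ 1) ×
         All (λ q → Any (λ d → q onDiag d) D) S)) →
    Σ (List (Diagonal n)) (λ E → Unique E × (length E ≡ 2 * C) ×
         All (λ d → Any (λ q → q onDiag d) S) E ×
         (sum (map diagLength E) ≥ n * C))
lemma2 (suc m) C S _ uncoverable = E , unique , length-E , onQueens , weight
  where
  P = take C (Pos.sortedImage S)
  N = take C (Neg.sortedImage S)
  E = P ++ N
  heavy = take-heavyPairs diagLength C (Pos.sortedImage S) (Neg.sortedImage S)
                          (uncoverable⇒heavyPairs C S uncoverable)
  unique : Unique E
  unique = Uniqueₚ.++⁺ (Uniqueₚ.take⁺ C (Pos.sortedImage-unique S)) (Uniqueₚ.take⁺ C (Neg.sortedImage-unique S))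
                       (take-sortedImages-disjoint C S)
  length-E : length E ≡ 2 * C
  length-E = trans (length-++ P) (cong₂ _+_ (proj₁ heavy) (trans (proj₁ (proj₂ heavy)) (sym (+-identityʳ C))))
  onQueens : All (λ d → Any (λ q → q onDiag d) S) E
  onQueens = Allₚ.++⁺ (All.map (λ { (q , q∈S , refl) → lose q∈S (onPosThrough-self q) }) (Pos.take-sortedImage⁻ C S))
                      (All.map (λ { (q , q∈S , refl) → lose q∈S (onNegThrough-self q) }) (Neg.take-sortedImage⁻ C S))
  weight : sum (map diagLength E) ≥ suc m * C
  weight = ≤-trans (proj₂ (proj₂ heavy)) (≤-reflexive (sym
    (trans (cong sum (map-++ diagLength P N)) (sum-++ (map diagLength P) (map diagLength N)))))
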